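{- Let $\lambda=(\lambda_1,\ldots,\lambda_t)$ be an unrefinable partition into distinct parts with $\#\mathcal{M}_\lambda=\lfloor\lambda_t/2\rfloor$. Then for every integer $x$ with $1\le x\le \lambda_t-1$ and $x\neq \lambda_t/2$, $x$ is a part of $\lambda$ if and only if $\lambda_t-x\in\mathcal{M}_\lambda$.
   Context: A partition into distinct parts is a sequence $\lambda=(\lambda_1,\ldots,\lambda_t)$ of positive integers with $\lambda_1<\cdots<\lambda_t$ and $t\ge 2$. Its set of missing parts is $\mathcal{M}_\lambda=\{1,\ldots,\lambda_t\}\setminus\{\lambda_1,\ldots,\lambda_t\}$. $\lambda$ is refinable if some part equals a sum of at least two pairwise distinct missing parts, and unrefinable otherwise. -}

module Defs where

open import Data.Nat using (ℕ; suc; _<_; _≤_)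
open import Data.Nat.Properties using (_≟_; _≤?_)
open import Data.List using (List; []; _∷_; length; filter; upTo)
open import Data.Nat.ListAction using (sum)
open import Relation.Binary.PropositionalEquality using (_≡_)
open import Data.List.Membership.Propositional using (_∈_; _∉_)
open import Data.List.Membership.DecPropositional _≟_ using (_∈?_)
open import Data.List.Relation.Unary.All using (All)
open import Data.List.Relation.Unary.AllPairs using (AllPairs)
open import Data.List.Relation.Unary.Unique.Propositional using (Unique)
open import Data.Product using (_×_; ∃-syntax)
open import Relation.Nullary using (¬_)
open import Relation.Nullary.Decidable using (_×-dec_; ¬?)

record DistinctPartition (ps : List ℕ) : Set where
  field
    increasing : AllPairs _<_ ps
    positive   : All (λ p → 1 ≤ p) ps
    atLeastTwo : 2 ≤ length ps

-- last element of a list (the largest part λ_t for an increasing list); 0 for []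
lastPart : List ℕ → ℕ
lastPart []           = 0
lastPart (p ∷ [])     = p
lastPart (_ ∷ q ∷ ps) = lastPart (q ∷ ps)

Missing : List ℕ → ℕ → Set
Missing ps m = (1 ≤ m × m ≤ lastPart ps) × m ∉ ps

missingList : List ℕ → List ℕ
missingList ps =
  filter (λ m → ((1 ≤? m) ×-dec (m ≤? lastPart ps)) ×-dec ¬? (m ∈? ps))
         (upTo (suc (lastPart ps)))

numMissing : List ℕ → ℕ
numMissing ps = length (missingList ps)

Refinable : List ℕ → Set
Refinable ps = ∃[ p ] ∃[ S ]
  (p ∈ ps × Unique S × 2 ≤ length S × All (Missing ps) S × sum S ≡ p)

Unrefinable : List ℕ → Set
Unrefinable ps = ¬ Refinable ps

-- Fold {1, …, N-1} onto {1, …, ⌊N/2⌋} by m ↦ min(m, N - m), N = λ_t being a part.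
-- Two distinct missing parts summing to N would refine N, so the fold is injective on
-- missing parts; as there are exactly ⌊N/2⌋ of them, every k ≤ ⌊N/2⌋ is the fold of a
-- missing part. Hence x and N - x are never both parts, and (for x ≠ N/2) never both
-- missing, which is the claimed equivalence.
module Submission where

open import Defs
open import Data.Nat using (ℕ; _≤_; _∸_; _*_; _/_)
open import Data.List.Membership.Propositional using (_∈_)
open import Relation.Binary.PropositionalEquality using (_≡_; _≢_)
open import Data.List using (List)
open import Function.Bundles using (_⇔_)

open import Data.Nat using (zero; suc; _+_; _<_; _⊓_; z≤n; s≤s)
open import Data.Nat.Properties
open import Data.Nat.DivMod using (m*n/n≡m; /-monoˡ-≤)
open import Data.List using ([]; _∷_; _++_; length; map; applyUpTo; upTo)
open import Data.List.Properties using (length-++-sucʳ; length-map; length-applyUpTo)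
open import Data.List.Membership.Propositional using (_∉_)
open import Data.List.Membership.Propositional.Properties
  using (∈-∃++; ∈-++⁻; ∈-++⁺ˡ; ∈-++⁺ʳ; ∈-filter⁻; ∈-map⁻; ∈-applyUpTo⁺)
open import Data.List.Membership.DecPropositional _≟_ using (_∈?_)
open import Data.List.Relation.Binary.Subset.Propositional using (_⊆_)
open import Data.List.Relation.Unary.Any using (here; there)
open import Data.List.Relation.Unary.All as All using (All; []; _∷_)
open import Data.List.Relation.Unary.All.Properties using (¬Any⇒All¬)
open import Data.List.Relation.Unary.AllPairs using (AllPairs; []; _∷_)
import Data.List.Relation.Unary.AllPairs.Properties as AllPairs
open import Data.List.Relation.Unary.Unique.Propositional using (Unique)
import Data.List.Relation.Unary.Unique.Propositional.Properties as Unique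
open import Relation.Binary.Definitions using (DecidableEquality)
open import Relation.Binary.PropositionalEquality using (refl; sym; trans; cong; subst; module ≡-Reasoning)
open import Data.Product using (_×_; _,_; proj₂; ∃-syntax)
open import Data.Sum using (_⊎_; inj₁; inj₂)
open import Data.Empty using (⊥-elim)
open import Relation.Nullary using (Dec; yes; no)
open import Relation.Nullary.Decidable using (_×-dec_; ¬?)
open import Function.Bundles using (mk⇔)

module _ {a} {A : Set a} where

  ∈-++-∷-≢ : ∀ {x y} (ys zs : List A) → x ∈ ys ++ y ∷ zs → x ≢ y → x ∈ ys ++ zs
  ∈-++-∷-≢ ys zs x∈ x≢y with ∈-++⁻ ys x∈
  ... | inj₁ x∈ys         = ∈-++⁺ˡ x∈ys
  ... | inj₂ (here x≡y)   = ⊥-elim (x≢y x≡y)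
  ... | inj₂ (there x∈zs) = ∈-++⁺ʳ ys x∈zs

  Unique-⊆⇒length-≤ : ∀ {xs ys : List A} → Unique xs → xs ⊆ ys → length xs ≤ length ys
  Unique-⊆⇒length-≤ {[]}     _              _     = z≤n
  Unique-⊆⇒length-≤ {x ∷ xs} (x∉xs ∷ uniq) x∷xs⊆ys with ∈-∃++ (x∷xs⊆ys (here refl))
  ... | ys , zs , refl = subst (suc (length xs) ≤_) (sym (length-++-sucʳ ys x zs))
    (s≤s (Unique-⊆⇒length-≤ uniq λ y∈xs →
      ∈-++-∷-≢ ys zs (x∷xs⊆ys (there y∈xs)) λ y≡x → All.lookup x∉xs y∈xs (sym y≡x)))


module _ {a} {A : Set a} (_≟ᴬ_ : DecidableEquality A) where
  open import Data.List.Membership.DecPropositional _≟ᴬ_ using () renaming (_∈?_ to _∈ᴬ?_)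

  Unique-⊆-length-≥⇒⊇ : ∀ {xs ys : List A} → Unique xs → xs ⊆ ys → length ys ≤ length xs → ys ⊆ xs
  Unique-⊆-length-≥⇒⊇ {xs} {ys} uniq xs⊆ys ys≤xs {y} y∈ys with y ∈ᴬ? xs
  ... | yes y∈xs = y∈xs
  ... | no  y∉xs = ⊥-elim (<-irrefl refl (≤-trans y∷xs≤ys ys≤xs))
    where
    y∷xs≤ys : length (y ∷ xs) ≤ length ys
    y∷xs≤ys = Unique-⊆⇒length-≤ (¬Any⇒All¬ xs y∉xs ∷ uniq)
                                 λ { (here refl) → y∈ys ; (there x∈xs) → xs⊆ys x∈xs }

AllPairs-within : ∀ {a p r s} {A : Set a} {P : A → Set p} {R : A → A → Set r} {S : A → A → Set s} →
                  (∀ {x y} → P x → P y → R x y → S x y) →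
                  ∀ {xs} → All P xs → AllPairs R xs → AllPairs S xs
AllPairs-within f []         []         = []
AllPairs-within f (px ∷ pxs) (rx ∷ rxs) =
  All.zipWith (λ (py , rxy) → f px py rxy) (pxs , rx) ∷ AllPairs-within f pxs rxs

≤∸1⇒< : ∀ {m n} → 1 ≤ m → m ≤ n ∸ 1 → m < n
≤∸1⇒< {n = zero} (s≤s _) ()
≤∸1⇒< {n = suc _}  _       m≤n = s≤s m≤n

≡∸⇒+≡ : ∀ {m n o} → n ≤ o → m ≡ o ∸ n → m + n ≡ o
≡∸⇒+≡ n≤o refl = m∸n+n≡m n≤o

∈-applyUpTo-suc : ∀ {k n} → 1 ≤ k → k ≤ n → k ∈ applyUpTo suc n
∈-applyUpTo-suc {suc k} _ k<n = ∈-applyUpTo⁺ suc k<n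

*2≤⇒≤/2 : ∀ {k n} → k * 2 ≤ n → k ≤ n / 2
*2≤⇒≤/2 {k} {n} k*2≤n = subst (_≤ n / 2) (m*n/n≡m k 2) (/-monoˡ-≤ 2 k*2≤n)

fold : ℕ → ℕ → ℕ
fold n m = m ⊓ (n ∸ m)

fold-positive : ∀ {m n} → 1 ≤ m → m < n → 1 ≤ fold n m
fold-positive 1≤m m<n = ⊓-glb 1≤m (m<n⇒0<n∸m m<n)

fold≤half : ∀ {m n} → m ≤ n → fold n m ≤ n / 2
fold≤half {m} {n} m≤n = *2≤⇒≤/2 (begin
  fold n m * 2                  ≡⟨ *-comm (fold n m) 2 ⟩
  fold n m + (fold n m + 0)     ≡⟨ cong (fold n m +_) (+-identityʳ (fold n m)) ⟩
  fold n m + fold n m           ≤⟨ +-mono-≤ (m⊓n≤m m (n ∸ m)) (m⊓n≤n m (n ∸ m)) ⟩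
  m + (n ∸ m)                   ≡⟨ m+[n∸m]≡n m≤n ⟩
  n                             ∎)
  where open ≤-Reasoning

fold-collision : ∀ {a b n} → a ≤ n → b ≤ n → fold n a ≡ fold n b → a ≡ b ⊎ a + b ≡ n
fold-collision {a} {b} {n} a≤n b≤n fa≡fb with ⊓-sel a (n ∸ a) | ⊓-sel b (n ∸ b)
... | inj₁ fa≡a   | inj₁ fb≡b   = inj₁ (trans (sym fa≡a) (trans fa≡fb fb≡b))
... | inj₁ fa≡a   | inj₂ fb≡n∸b = inj₂ (≡∸⇒+≡ b≤n (trans (sym fa≡a) (trans fa≡fb fb≡n∸b)))
... | inj₂ fa≡n∸a | inj₁ fb≡b   =
  inj₂ (trans (+-comm a b) (≡∸⇒+≡ a≤n (trans (sym fb≡b) (trans (sym fa≡fb) fa≡n∸a))))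
... | inj₂ fa≡n∸a | inj₂ fb≡n∸b =
  inj₁ (∸-cancelˡ-≡ a≤n b≤n (trans (sym fa≡n∸a) (trans fa≡fb fb≡n∸b)))

lastPart-∈ : ∀ {ps} → 1 ≤ length ps → lastPart ps ∈ ps
lastPart-∈ {_ ∷ []}     _ = here refl
lastPart-∈ {_ ∷ q ∷ ps} _ = there (lastPart-∈ {q ∷ ps} (s≤s z≤n))

missing? : ∀ ps m → Dec (Missing ps m)
missing? ps m = ((1 ≤? m) ×-dec (m ≤? lastPart ps)) ×-dec ¬? (m ∈? ps)

∈-missingList⁻ : ∀ {ps m} → m ∈ missingList ps → Missing ps m
∈-missingList⁻ {ps} m∈ = proj₂ (∈-filter⁻ (missing? ps) {xs = upTo (suc (lastPart ps))} m∈)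

missingList-unique : ∀ ps → Unique (missingList ps)
missingList-unique ps = Unique.filter⁺ (missing? ps) (Unique.upTo⁺ (suc (lastPart ps)))

unrefinable⇒missing-pair-sum-∉ : ∀ {ps p a b} → Unrefinable ps → p ∈ ps →
  Missing ps a → Missing ps b → a ≢ b → a + b ≢ p
unrefinable⇒missing-pair-sum-∉ {b = b} unrefinable p∈ps ma mb a≢b a+b≡p =
  unrefinable (_ , _ ∷ _ ∷ [] , p∈ps , (a≢b ∷ []) ∷ [] ∷ [] , s≤s (s≤s z≤n) ,
               ma ∷ mb ∷ [] , trans (cong (_ +_) (+-identityʳ b)) a+b≡p)

module _ {ps : List ℕ} (N∈ps : lastPart ps ∈ ps) (unrefinable : Unrefinable ps) where

  missing<lastPart : ∀ {m} → Missing ps m → m < lastPart ps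
  missing<lastPart ((_ , m≤N) , m∉ps) = ≤∧≢⇒< m≤N λ { refl → m∉ps N∈ps }

  fold-injective-on-missing : ∀ {a b} → Missing ps a → Missing ps b →
                              fold (lastPart ps) a ≡ fold (lastPart ps) b → a ≡ b
  fold-injective-on-missing {a} {b} ma@((_ , a≤N) , _) mb@((_ , b≤N) , _) fa≡fb
    with fold-collision a≤N b≤N fa≡fb | a ≟ b
  ... | inj₁ a≡b   | _       = a≡b
  ... | inj₂ _     | yes a≡b = a≡b
  ... | inj₂ a+b≡N | no a≢b  = ⊥-elim (unrefinable⇒missing-pair-sum-∉ unrefinable N∈ps ma mb a≢b a+b≡N)

  missing-folds-unique : Unique (map (fold (lastPart ps)) (missingList ps))
  missing-folds-unique = AllPairs.map⁺ (AllPairs-within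
    (λ ma mb a≢b fa≡fb → a≢b (fold-injective-on-missing ma mb fa≡fb))
    (All.tabulate ∈-missingList⁻) (missingList-unique ps))

  missing-folds-⊆ : map (fold (lastPart ps)) (missingList ps) ⊆ applyUpTo suc (lastPart ps / 2)
  missing-folds-⊆ k∈ with ∈-map⁻ (fold (lastPart ps)) k∈
  ... | m , m∈ , refl with ∈-missingList⁻ m∈
  ... | mm@((1≤m , m≤N) , _) =
    ∈-applyUpTo-suc (fold-positive 1≤m (missing<lastPart mm)) (fold≤half m≤N)

  fold-of-missing-onto : numMissing ps ≡ lastPart ps / 2 → ∀ {k} → 1 ≤ k → k ≤ lastPart ps / 2 →
                         ∃[ m ] Missing ps m × k ≡ fold (lastPart ps) m
  fold-of-missing-onto #missing {k} 1≤k k≤N/2 =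
    let m , m∈ , k≡fm = ∈-map⁻ (fold N) k∈folds in m , ∈-missingList⁻ m∈ , k≡fm
    where
    N = lastPart ps

    enough-folds : length (applyUpTo suc (N / 2)) ≤ length (map (fold N) (missingList ps))
    enough-folds = ≤-reflexive (begin
      length (applyUpTo suc (N / 2))           ≡⟨ length-applyUpTo suc (N / 2) ⟩
      N / 2                                    ≡⟨ sym #missing ⟩
      length (missingList ps)                  ≡⟨ sym (length-map (fold N) (missingList ps)) ⟩
      length (map (fold N) (missingList ps))   ∎)
      where open ≡-Reasoning

    k∈folds : k ∈ map (fold N) (missingList ps)
    k∈folds = Unique-⊆-length-≥⇒⊇ _≟_ missing-folds-unique missing-folds-⊆ enough-folds
                                  (∈-applyUpTo-suc 1≤k k≤N/2)

  part⇒complement-∉ : numMissing ps ≡ lastPart ps / 2 → ∀ {x} → 1 ≤ x → x < lastPart ps →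
                      x ∈ ps → lastPart ps ∸ x ∉ ps
  part⇒complement-∉ #missing {x} 1≤x x<N x∈ps N∸x∈ps
    with fold-of-missing-onto #missing (fold-positive 1≤x x<N) (fold≤half (<⇒≤ x<N))
  ... | m , ((_ , m≤N) , m∉ps) , fx≡fm with fold-collision m≤N (<⇒≤ x<N) (sym fx≡fm)
  ... | inj₁ refl  = m∉ps x∈ps
  ... | inj₂ m+x≡N = m∉ps (subst (_∈ ps) (trans (cong (_∸ x) (sym m+x≡N)) (m+n∸n≡m m x)) N∸x∈ps)

  complement-missing⇒part : ∀ {x} → 1 ≤ x → x < lastPart ps → 2 * x ≢ lastPart ps →
                            Missing ps (lastPart ps ∸ x) → x ∈ ps
  complement-missing⇒part {x} 1≤x x<N 2x≢N missing-N∸x with x ∈? ps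
  ... | yes x∈ps = x∈ps
  ... | no  x∉ps = ⊥-elim (unrefinable⇒missing-pair-sum-∉ unrefinable N∈ps
                             ((1≤x , <⇒≤ x<N) , x∉ps) missing-N∸x x≢N∸x x+[N∸x]≡N)
    where
    x+[N∸x]≡N : x + (lastPart ps ∸ x) ≡ lastPart ps
    x+[N∸x]≡N = m+[n∸m]≡n (<⇒≤ x<N)

    x≢N∸x : x ≢ lastPart ps ∸ x
    x≢N∸x x≡N∸x = 2x≢N (trans (cong (x +_) (trans (+-identityʳ x) x≡N∸x)) x+[N∸x]≡N)

mainTheorem7 : (ps : List ℕ) → DistinctPartition ps → Unrefinable ps →
    numMissing ps ≡ lastPart ps / 2 →
    (x : ℕ) → 1 ≤ x → x ≤ lastPart ps ∸ 1 → 2 * x ≢ lastPart ps →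
    (x ∈ ps ⇔ Missing ps (lastPart ps ∸ x))
mainTheorem7 ps partition unrefinable #missing x 1≤x x≤N∸1 2x≢N =
  mk⇔ (λ x∈ps → (m<n⇒0<n∸m x<N , m∸n≤m (lastPart ps) x) ,
                part⇒complement-∉ N∈ps unrefinable #missing 1≤x x<N x∈ps)
      (complement-missing⇒part N∈ps unrefinable 1≤x x<N 2x≢N)
  where
  x<N : x < lastPart ps
  x<N = ≤∸1⇒< 1≤x x≤N∸1

  N∈ps : lastPart ps ∈ ps
  N∈ps = lastPart-∈ (<⇒≤ (DistinctPartition.atLeastTwo partition))
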